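{- Let $x= P(x)$ be a PPS in $n$ variables in simple normal form, with LFP $q^*$ satisfying $\mathbf{0} < q^* < \mathbf{1}$, and let $B(x)$ be the Jacobian matrix of $P(x)$. Then for all $z \in \mathbb{R}^n$ with $\mathbf{0} \leq z \leq \frac{1}{2}(\mathbf{1} + q^*)$, we have $B(z)(\mathbf{1}-q^*) \leq \mathbf{1}-q^*$. In particular, $B(\frac{1}{2}(\mathbf{1} + q^*))(\mathbf{1}-q^*) \leq \mathbf{1}-q^*$ and $B(q^*)(\mathbf{1}-q^*) \leq \mathbf{1}-q^*$.
   Context: A PPS is a system $x_i = P_i(x)$, $i=1,\dots,n$, with each $P_i$ a polynomial with nonnegative coefficients (including constant term) summing to at most $1$; its LFP $q^*$ is the coordinatewise least nonnegative solution. Simple normal form: each $P_i$ is either $x_jx_k$ or linear $\sum_j p_{i,j}x_j+p_{i,0}$. $B(x)_{i,j}=\partial P_i/\partial x_j$. Vector inequalities are coordinatewise. -}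

module Defs where

open import Level using (0ℓ)
open import Data.Nat using (ℕ; zero; suc)
open import Data.Fin using (Fin; zero; suc; _≟_)
open import Data.Product using (Σ; ∃; _×_; _,_)
open import Data.Unit using (⊤)
open import Relation.Nullary using (¬_; yes; no)
open import Algebra.Bundles using (CommutativeRing)
open import Relation.Binary.Structures using (IsTotalOrder)

-- The real numbers, axiomatised as a (Dedekind-)complete ordered field.
-- Any two such structures are isomorphic, so quantifying over them is
-- the same as talking about ℝ.
record RealField : Set₁ where
  field
    commRing : CommutativeRing 0ℓ 0ℓ
  open CommutativeRing commRing public using (Carrier; _≈_; _+_; _*_; -_; _-_; 0#; 1#)
  field
    _≤_          : Carrier → Carrier → Set
    isTotalOrder : IsTotalOrder _≈_ _≤_
    0≉1          : ¬ (0# ≈ 1#)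
    inverse      : ∀ x → ¬ (x ≈ 0#) → Σ Carrier λ y → x * y ≈ 1#
    +-mono-≤     : ∀ {x y} z → x ≤ y → (x + z) ≤ (y + z)
    *-nonneg     : ∀ {x y} → 0# ≤ x → 0# ≤ y → 0# ≤ (x * y)
    complete     : (S : Carrier → Set) → Σ Carrier S →
                   Σ Carrier (λ b → ∀ x → S x → x ≤ b) →
                   Σ Carrier (λ s → (∀ x → S x → x ≤ s) ×
                                    (∀ b → (∀ x → S x → x ≤ b) → s ≤ b))

  _<_ : Carrier → Carrier → Set
  x < y = (x ≤ y) × ¬ (x ≈ y)

module PPSDefs (ℝ : RealField) where
  open RealField ℝ public

  Σᶠ : ∀ {n} → (Fin n → Carrier) → Carrier
  Σᶠ {zero}  f = 0#
  Σᶠ {suc n} f = f zero + Σᶠ (λ i → f (suc i))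

  data SNF (n : ℕ) : Set where
    quad : Fin n → Fin n → SNF n
    lin  : (Fin n → Carrier) → Carrier → SNF n

  PPS : ℕ → Set
  PPS n = Fin n → SNF n

  -- Probabilistic side conditions: nonnegative coefficients summing to ≤ 1.
  -- (For quad the only coefficient is 1.)
  WellFormedEqn : ∀ {n} → SNF n → Set
  WellFormedEqn (quad j k) = ⊤
  WellFormedEqn (lin p p₀) = (∀ j → 0# ≤ p j) × (0# ≤ p₀) × ((Σᶠ p + p₀) ≤ 1#)

  IsPPS : ∀ {n} → PPS n → Set
  IsPPS P = ∀ i → WellFormedEqn (P i)

  Vecℝ : ℕ → Set
  Vecℝ n = Fin n → Carrier

  evalEqn : ∀ {n} → SNF n → Vecℝ n → Carrier
  evalEqn (quad j k) x = x j * x k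
  evalEqn (lin p p₀) x = Σᶠ (λ j → p j * x j) + p₀

  eval : ∀ {n} → PPS n → Vecℝ n → Vecℝ n
  eval P x i = evalEqn (P i) x

  _≤ᵛ_ : ∀ {n} → Vecℝ n → Vecℝ n → Set
  x ≤ᵛ y = ∀ i → x i ≤ y i

  _<ᵛ_ : ∀ {n} → Vecℝ n → Vecℝ n → Set
  x <ᵛ y = ∀ i → x i < y i

  𝟎 𝟏 : ∀ {n} → Vecℝ n
  𝟎 _ = 0#
  𝟏 _ = 1#

  IsLFP : ∀ {n} → PPS n → Vecℝ n → Set
  IsLFP P q = (𝟎 ≤ᵛ q) × (∀ i → q i ≈ eval P q i)
            × (∀ y → 𝟎 ≤ᵛ y → (∀ i → y i ≈ eval P y i) → q ≤ᵛ y)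

  δ : ∀ {n} → Fin n → Fin n → Carrier
  δ a b with a ≟ b
  ... | yes _ = 1#
  ... | no  _ = 0#

  ∂Eqn : ∀ {n} → SNF n → Fin n → Vecℝ n → Carrier
  ∂Eqn (quad j k) m x = δ m j * x k + δ m k * x j
  ∂Eqn (lin p p₀) m x = p m

  B : ∀ {n} → PPS n → Vecℝ n → Fin n → Fin n → Carrier
  B P x i m = ∂Eqn (P i) m x

  _·_ : ∀ {n} → (Fin n → Fin n → Carrier) → Vecℝ n → Vecℝ n
  (M · v) i = Σᶠ (λ m → M i m * v m)

-- A linear row gives
--   Σ p_m (1 − q*_m) = Σ p_m − Σ p_m q*_m ≤ 1 − p₀ − Σ p_m q*_m = 1 − q*_i.
-- A quadratic row x_j x_k gives, using 2z ≤ 1 + q* and 1 − q* ≥ 0,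
--   2 (z_k (1 − q*_j) + z_j (1 − q*_k)) ≤ (1 + q*_k)(1 − q*_j) + (1 + q*_j)(1 − q*_k) = 2 (1 − q*_j q*_k),
-- and q*_j q*_k = q*_i.  Only q* = P(q*) and q* ≤ 1 are used.

module Submission where

open import Defs
open import Data.Nat using (ℕ; suc)
open import Data.Fin as Fin using (Fin; _≟_; punchIn)
open import Data.Fin.Properties using (punchInᵢ≢i)
open import Data.Product using (_×_; _,_; proj₁)
open import Data.Vec.Functional using (removeAt)
open import Data.Sum using (inj₁; inj₂)
open import Data.Maybe using (nothing)
open import Algebra.Bundles using (CommutativeRing)
open import Relation.Binary.Bundles using (Poset)
open import Relation.Binary.Structures using (IsTotalOrder)
open import Relation.Binary.PropositionalEquality using (_≡_; _≢_; cong; cong₂) renaming (refl to ≡-refl)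
open import Relation.Nullary using (yes; no; contradiction)

module PPSProperties (ℝ : RealField) where
  open PPSDefs ℝ
  open CommutativeRing commRing using
    ( refl; sym; trans; +-cong; +-congˡ; +-congʳ; *-congˡ; *-congʳ; -‿cong
    ; +-comm; +-assoc; +-identityˡ; *-assoc; *-identityˡ; *-identityʳ; distribˡ; distribʳ; -‿inverseʳ
    ; zeroˡ; +-identityʳ; ring; +-group; +-commutativeMonoid; commutativeSemiring )
  open IsTotalOrder isTotalOrder using (total; isPartialOrder)
  open import Algebra.Properties.Group +-group using (//-rightDividesˡ; //-rightDividesʳ; \\-leftDividesʳ)
  open import Algebra.Properties.Ring ring using ([y-z]x≈yx-zx; -1*x≈-x)
  open import Algebra.Properties.CommutativeMonoid.Sum +-commutativeMonoid
    using (sum; sum-cong-≋; ∑-distrib-+; sum-remove; sum-replicate-zero)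
  open import Algebra.Solver.Ring.NaturalCoefficients commutativeSemiring (λ _ _ → nothing)
    using (solve; _:+_; _:*_; _:=_; con)

  poset : Poset _ _ _
  poset = record { isPartialOrder = isPartialOrder }

  open import Relation.Binary.Reasoning.PartialOrder poset

  +-monoʳ-≤ : ∀ z {x y} → x ≤ y → (z + x) ≤ (z + y)
  +-monoʳ-≤ z {x} {y} x≤y = begin
    z + x  ≈⟨ +-comm z x ⟩
    x + z  ≤⟨ +-mono-≤ z x≤y ⟩
    y + z  ≈⟨ +-comm y z ⟩
    z + y  ∎

  +-mono₂-≤ : ∀ {x y u v} → x ≤ y → u ≤ v → (x + u) ≤ (y + v)
  +-mono₂-≤ {x} {y} {u} {v} x≤y u≤v = begin
    x + u  ≤⟨ +-mono-≤ u x≤y ⟩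
    y + u  ≤⟨ +-monoʳ-≤ y u≤v ⟩
    y + v  ∎

  +-cancelˡ-≤ : ∀ z {x y} → (z + x) ≤ (z + y) → x ≤ y
  +-cancelˡ-≤ z {x} {y} z+x≤z+y = begin
    x                ≈⟨ \\-leftDividesʳ z x ⟨
    - z + (z + x)    ≤⟨ +-monoʳ-≤ (- z) z+x≤z+y ⟩
    - z + (z + y)    ≈⟨ \\-leftDividesʳ z y ⟩
    y                ∎

  x+z≤y⇒x≤y-z : ∀ {x y z} → (x + z) ≤ y → x ≤ (y - z)
  x+z≤y⇒x≤y-z {x} {y} {z} x+z≤y = begin
    x            ≈⟨ //-rightDividesʳ z x ⟨
    (x + z) - z  ≤⟨ +-mono-≤ (- z) x+z≤y ⟩
    y - z        ∎

  x≤y⇒0≤y-x : ∀ {x y} → x ≤ y → 0# ≤ (y - x)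
  x≤y⇒0≤y-x {x} {y} x≤y = begin
    0#     ≈⟨ -‿inverseʳ x ⟨
    x - x  ≤⟨ +-mono-≤ (- x) x≤y ⟩
    y - x  ∎

  0≤y-x⇒x≤y : ∀ {x y} → 0# ≤ (y - x) → x ≤ y
  0≤y-x⇒x≤y {x} {y} 0≤y-x = begin
    x            ≈⟨ +-identityˡ x ⟨
    0# + x       ≤⟨ +-mono-≤ x 0≤y-x ⟩
    (y - x) + x  ≈⟨ //-rightDividesˡ x y ⟩
    y            ∎

  *-monoˡ-≤-nonNeg : ∀ {x y z} → 0# ≤ z → x ≤ y → (x * z) ≤ (y * z)
  *-monoˡ-≤-nonNeg {x} {y} {z} 0≤z x≤y = 0≤y-x⇒x≤y (begin
    0#             ≤⟨ *-nonneg (x≤y⇒0≤y-x x≤y) 0≤z ⟩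
    (y - x) * z    ≈⟨ [y-z]x≈yx-zx z y x ⟩
    y * z - x * z  ∎)

  2x≈x+x : ∀ x → (1# + 1#) * x ≈ x + x
  2x≈x+x x = trans (distribʳ x 1# 1#) (+-cong (*-identityˡ x) (*-identityˡ x))

  2x≤1+x : ∀ {x} → x ≤ 1# → ((1# + 1#) * x) ≤ (1# + x)
  2x≤1+x {x} x≤1 = begin
    (1# + 1#) * x  ≈⟨ 2x≈x+x x ⟩
    x + x          ≤⟨ +-mono-≤ x x≤1 ⟩
    1# + x         ∎

  *-cancelˡ-≤-2 : ∀ {x y} → ((1# + 1#) * x) ≤ ((1# + 1#) * y) → x ≤ y
  *-cancelˡ-≤-2 {x} {y} 2x≤2y with total x y
  ... | inj₁ x≤y = x≤y
  ... | inj₂ y≤x = +-cancelˡ-≤ x (begin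
    x + x            ≈⟨ 2x≈x+x x ⟨
    (1# + 1#) * x    ≤⟨ 2x≤2y ⟩
    (1# + 1#) * y    ≈⟨ 2x≈x+x y ⟩
    y + y            ≤⟨ +-mono-≤ y y≤x ⟩
    x + y            ∎)

  x[1-y]+xy≈x : ∀ x y → x * (1# - y) + x * y ≈ x
  x[1-y]+xy≈x x y = begin-equality
    x * (1# - y) + x * y  ≈⟨ distribˡ x (1# - y) y ⟨
    x * ((1# - y) + y)    ≈⟨ *-congˡ (//-rightDividesˡ y 1#) ⟩
    x * 1#                ≈⟨ *-identityʳ x ⟩
    x                     ∎

  -- The solver has only natural coefficients, so −1 enters as an atom ν with ν * t ≈ - t and 1 + ν ≈ 0.
  [1+y][1-x]+[1+x][1-y]≈2[1-xy] : ∀ x y →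
    (1# + y) * (1# - x) + (1# + x) * (1# - y) ≈ (1# + 1#) * (1# - x * y)
  [1+y][1-x]+[1+x][1-y]≈2[1-xy] x y = begin-equality
    (1# + y) * (1# - x) + (1# + x) * (1# - y)
      ≈⟨ +-cong (*-congˡ (+-congˡ (neg x))) (*-congˡ (+-congˡ (neg y))) ⟩
    (1# + y) * (1# + ν * x) + (1# + x) * (1# + ν * y)
      ≈⟨ solve 3 (λ x y ν → (con 1 :+ y) :* (con 1 :+ ν :* x) :+ (con 1 :+ x) :* (con 1 :+ ν :* y)
                          := (con 1 :+ con 1) :* (con 1 :+ ν :* (x :* y)) :+ (con 1 :+ ν) :* (x :+ y))
               refl x y ν ⟩
    (1# + 1#) * (1# + ν * (x * y)) + (1# + ν) * (x + y)
      ≈⟨ +-congˡ (trans (*-congʳ (-‿inverseʳ 1#)) (zeroˡ (x + y))) ⟩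
    (1# + 1#) * (1# + ν * (x * y)) + 0#
      ≈⟨ +-identityʳ _ ⟩
    (1# + 1#) * (1# + ν * (x * y))
      ≈⟨ *-congˡ (+-congˡ (neg (x * y))) ⟨
    (1# + 1#) * (1# - x * y)  ∎
    where
    ν : Carrier
    ν = - 1#
    neg : ∀ t → - t ≈ ν * t
    neg t = sym (-1*x≈-x t)

  Σᶠ≡sum : ∀ {n} (f : Fin n → Carrier) → Σᶠ f ≡ sum f
  Σᶠ≡sum {0}     f = ≡-refl
  Σᶠ≡sum {suc n} f = cong (f Fin.zero +_) (Σᶠ≡sum (λ i → f (Fin.suc i)))

  Σᶠ-cong : ∀ {n} {f g : Fin n → Carrier} → (∀ i → f i ≈ g i) → Σᶠ f ≈ Σᶠ g
  Σᶠ-cong {f = f} {g} f≈g = begin-equality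
    Σᶠ f  ≡⟨ Σᶠ≡sum f ⟩
    sum f ≈⟨ sum-cong-≋ f≈g ⟩
    sum g ≡⟨ Σᶠ≡sum g ⟨
    Σᶠ g  ∎

  Σᶠ-distrib-+ : ∀ {n} (f g : Fin n → Carrier) → Σᶠ (λ i → f i + g i) ≈ Σᶠ f + Σᶠ g
  Σᶠ-distrib-+ f g = begin-equality
    Σᶠ (λ i → f i + g i)  ≡⟨ Σᶠ≡sum (λ i → f i + g i) ⟩
    sum (λ i → f i + g i) ≈⟨ ∑-distrib-+ f g ⟩
    sum f + sum g         ≡⟨ cong₂ _+_ (Σᶠ≡sum f) (Σᶠ≡sum g) ⟨
    Σᶠ f + Σᶠ g           ∎

  δ-diag : ∀ {n} (j : Fin n) → δ j j ≈ 1#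
  δ-diag j with j ≟ j
  ... | yes _   = refl
  ... | no j≢j = contradiction ≡-refl j≢j

  δ-off : ∀ {n} {m j : Fin n} → m ≢ j → δ m j ≈ 0#
  δ-off {m = m} {j} m≢j with m ≟ j
  ... | yes m≡j = contradiction m≡j m≢j
  ... | no _    = refl

  Σᶠ-δ : ∀ {n} (j : Fin n) (f : Fin n → Carrier) → Σᶠ (λ m → δ m j * f m) ≈ f j
  Σᶠ-δ {suc n} j f = begin-equality
    Σᶠ t                           ≡⟨ Σᶠ≡sum t ⟩
    sum t                          ≈⟨ sum-remove {i = j} t ⟩
    t j + sum (removeAt t j)       ≈⟨ +-cong (*-congʳ (δ-diag j)) (sum-cong-≋ off-diagonal) ⟩
    1# * f j + sum {n} (λ _ → 0#)  ≈⟨ +-cong (*-identityˡ (f j)) (sum-replicate-zero n) ⟩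
    f j + 0#                       ≈⟨ +-identityʳ (f j) ⟩
    f j                            ∎
    where
    t : Fin (suc n) → Carrier
    t m = δ m j * f m
    off-diagonal : ∀ i → t (punchIn j i) ≈ 0#
    off-diagonal i = trans (*-congʳ (δ-off (punchInᵢ≢i j i))) (zeroˡ (f (punchIn j i)))

  Σᶠ-δ₂ : ∀ {n} (j k : Fin n) (a b : Carrier) (f : Fin n → Carrier) →
    Σᶠ (λ m → (δ m j * a + δ m k * b) * f m) ≈ a * f j + b * f k
  Σᶠ-δ₂ j k a b f = begin-equality
    Σᶠ (λ m → (δ m j * a + δ m k * b) * f m)
      ≈⟨ Σᶠ-cong (λ m → trans (distribʳ (f m) (δ m j * a) (δ m k * b))
                             (+-cong (*-assoc (δ m j) a (f m)) (*-assoc (δ m k) b (f m)))) ⟩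
    Σᶠ (λ m → δ m j * (a * f m) + δ m k * (b * f m))
      ≈⟨ Σᶠ-distrib-+ (λ m → δ m j * (a * f m)) (λ m → δ m k * (b * f m)) ⟩
    Σᶠ (λ m → δ m j * (a * f m)) + Σᶠ (λ m → δ m k * (b * f m))
      ≈⟨ +-cong (Σᶠ-δ j (λ m → a * f m)) (Σᶠ-δ k (λ m → b * f m)) ⟩
    a * f j + b * f k  ∎

  module _ {n} (q z : Vecℝ n) (q≤1 : q ≤ᵛ 𝟏) (2z≤1+q : ∀ i → ((1# + 1#) * z i) ≤ (1# + q i)) where

    ∂Eqn-bound : (e : SNF n) → WellFormedEqn e → (qᵢ : Carrier) → qᵢ ≈ evalEqn e q →
      Σᶠ (λ m → ∂Eqn e m z * (1# - q m)) ≤ (1# - qᵢ)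
    ∂Eqn-bound (lin p p₀) (_ , _ , Σp+p₀≤1) qᵢ qᵢ≈Pᵢq = x+z≤y⇒x≤y-z (begin
      Σᶠ (λ m → p m * (1# - q m)) + qᵢ
        ≈⟨ +-congˡ qᵢ≈Pᵢq ⟩
      Σᶠ (λ m → p m * (1# - q m)) + (Σᶠ (λ m → p m * q m) + p₀)
        ≈⟨ +-assoc _ _ p₀ ⟨
      (Σᶠ (λ m → p m * (1# - q m)) + Σᶠ (λ m → p m * q m)) + p₀
        ≈⟨ +-congʳ (Σᶠ-distrib-+ (λ m → p m * (1# - q m)) (λ m → p m * q m)) ⟨
      Σᶠ (λ m → p m * (1# - q m) + p m * q m) + p₀
        ≈⟨ +-congʳ (Σᶠ-cong (λ m → x[1-y]+xy≈x (p m) (q m))) ⟩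
      Σᶠ p + p₀
        ≤⟨ Σp+p₀≤1 ⟩
      1#  ∎)
    ∂Eqn-bound (quad j k) _ qᵢ qᵢ≈qⱼqₖ = *-cancelˡ-≤-2 (begin
      (1# + 1#) * Σᶠ (λ m → (δ m j * z k + δ m k * z j) * (1# - q m))
        ≈⟨ *-congˡ (Σᶠ-δ₂ j k (z k) (z j) (λ m → 1# - q m)) ⟩
      (1# + 1#) * (z k * (1# - q j) + z j * (1# - q k))
        ≈⟨ trans (distribˡ _ _ _) (+-cong (sym (*-assoc _ _ _)) (sym (*-assoc _ _ _))) ⟩
      ((1# + 1#) * z k) * (1# - q j) + ((1# + 1#) * z j) * (1# - q k)
        ≤⟨ +-mono₂-≤ (*-monoˡ-≤-nonNeg (x≤y⇒0≤y-x (q≤1 j)) (2z≤1+q k))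
                     (*-monoˡ-≤-nonNeg (x≤y⇒0≤y-x (q≤1 k)) (2z≤1+q j)) ⟩
      (1# + q k) * (1# - q j) + (1# + q j) * (1# - q k)
        ≈⟨ [1+y][1-x]+[1+x][1-y]≈2[1-xy] (q j) (q k) ⟩
      (1# + 1#) * (1# - q j * q k)
        ≈⟨ *-congˡ (+-congˡ (-‿cong qᵢ≈qⱼqₖ)) ⟨
      (1# + 1#) * (1# - qᵢ)  ∎)

    Jacobian-bound : (P : PPS n) → IsPPS P → (∀ i → q i ≈ eval P q i) →
      (B P z · (λ i → 1# - q i)) ≤ᵛ (λ i → 1# - q i)
    Jacobian-bound P wf fixed i = ∂Eqn-bound (P i) (wf i) (q i) (fixed i)

lemma3p5 : (ℝ : RealField) → let open PPSDefs ℝ in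
    (n : ℕ) (P : PPS n) → IsPPS P → (q : Vecℝ n) → IsLFP P q →
    𝟎 <ᵛ q → q <ᵛ 𝟏 →
    ((z : Vecℝ n) → 𝟎 ≤ᵛ z → (∀ i → ((1# + 1#) * z i) ≤ (1# + q i)) →
    (B P z · (λ i → 1# - q i)) ≤ᵛ (λ i → 1# - q i))
    × ((h : Vecℝ n) → (∀ i → ((1# + 1#) * h i) ≈ (1# + q i)) →
    (B P h · (λ i → 1# - q i)) ≤ᵛ (λ i → 1# - q i))
    × ((B P q · (λ i → 1# - q i)) ≤ᵛ (λ i → 1# - q i))
lemma3p5 ℝ n P wf q (_ , fixed , _) _ q<1 =
    (λ z _ 2z≤1+q → Jacobian-bound q z q≤1 2z≤1+q P wf fixed)
  , (λ h 2h≈1+q → Jacobian-bound q h q≤1 (λ i → reflexive (2h≈1+q i)) P wf fixed)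
  , Jacobian-bound q q q≤1 (λ i → 2x≤1+x (q≤1 i)) P wf fixed
  where
  open PPSDefs ℝ
  open PPSProperties ℝ
  open IsTotalOrder isTotalOrder using (reflexive)
  q≤1 : q ≤ᵛ 𝟏
  q≤1 i = proj₁ (q<1 i)
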